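{- Completeness of $\vdash_2$ fails with two expansion variables. Let $a\in\mathcal A$, $e_1,e_2\in\mathcal E$ with $e_1\neq e_2$, and $Nat_0=(e_1a\to a)\to(e_2a\to a)$. Then $\lambda f^0.f^0\in[Nat_0]$, but it is not the case that $\lambda f^0.f^0:\langle()\vdash_2 Nat_0\rangle$.
   Context: Terms ($\lambda I^{\mathbb N}$-calculus). Fix a denumerably infinite set $\mathcal V$ of variable names, partitioned as $\mathcal V=\mathcal V_1\cup\mathcal V_2$ with $\mathcal V_1,\mathcal V_2$ disjoint and denumerably infinite. Indexed variables are $x^n$ with $x\in\mathcal V$, $n\in\mathbb N$. The set $\mathcal M$ of terms, the set $\mathbb M\subseteq\mathcal M$ of good terms, free variables $FV$ and degree $d$ are defined simultaneously: $x^n\in\mathcal M\cap\mathbb M$, $FV(x^n)=\{x^n\}$, $d(x^n)=n$; if $M,N\in\mathcal M$ are joinable ($M\diamond N$: for all $x$, $x^m\in FV(M)$ and $x^n\in FV(N)$ imply $m=n$) then $MN\in\mathcal M$, $FV(MN)=FV(M)\cup FV(N)$, $d(MN)=\min(d(M),d(N))$, and $MN\in\mathbb M$ if moreover $M,N\in\mathbb M$ and $d(M)\le d(N)$; if $M\in\mathcal M$ and $x^n\in FV(M)$ then $\lambda x^n.M\in\mathcal M$, $FV(\lambda x^n.M)=FV(M)\setminus\{x^n\}$, $d(\lambda x^n.M)=d(M)$, and $\lambda x^n.M\in\mathbb M$ if $M\in\mathbb M$. $\mathcal M^0$ ($\mathbb M^0$) is the set of terms (good terms) of degree $0$. Terms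 are taken modulo $\alpha$-conversion; substitution is defined only when all involved terms are pairwise joinable. $\rhd_\beta$ is the least compatible relation containing $(\lambda x^n.M)N\rhd_\beta M[x^n:=N]$ when $d(N)=n$; $\rhd_\beta^*$ is its reflexive-transitive closure. $M^+$ replaces every variable index $n$ in $M$ by $n+1$; $\mathcal X^+=\{M^+\mid M\in\mathcal X\}$. Types. Fix denumerably infinite sets $\mathcal A$ and $\mathcal E$. $\mathbb U::=\mathbb U\sqcap\mathbb U\mid e\,\mathbb U\mid\mathbb T$, $\mathbb T::=a\mid\mathbb U\to\mathbb T$ ($a\in\mathcal A$, $e\in\mathcal E$), quotiented by commutativity, associativity, idempotence of $\sqcap$ and $e(U_1\sqcap U_2)=eU_1\sqcap eU_2$. Degree: $d(a)=0$, $d(U\to T)=\min(d(U),d(T))$, $d(eU)=d(U)+1$, $d(U\sqcap V)=\min(d(U),d(V))$. Good types: atoms; $eU$ if $U$ good; $U\to T$ if $U,T$ good and $d(U)\ge d(T)$; $U\sqcap V$ if $U,V$ good and $d(U)=d(V)$. Environments: finite sets $(x_i^{n_i}:U_i)_i$ with distinct $x_i^{n_i}$; $()$ is the empty environment; $\Gamma,x^m:U$ adds a declaration for $x^m\notin dom(\Gamma)$; $\Gamma_1\sqcap\Gamma_2$ intersects types of common variables and keeps the rest; $e\Gamma=(x_i^{n_i+1}:eU_i)_i$; $\Gamma_1\diamond\Gamma_2$ iff any $x^m\in dom(\Gamma_1)$, $x^n\in dom(\Gamma_2)$ have $m=n$. Typing system $\vdash_2$ ($U$ over $\mathbb U$,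 $T$ over $\mathbb T$): (ax) $x^0:\langle(x^0:T)\vdash_2T\rangle$ if $T$ good; ($\to_I$) from $M:\langle\Gamma,x^n:U\vdash_2 T\rangle$ infer $\lambda x^n.M:\langle\Gamma\vdash_2 U\to T\rangle$; ($\to_E$) from $M_1:\langle\Gamma_1\vdash_2 U\to T\rangle$, $M_2:\langle\Gamma_2\vdash_2 U\rangle$, $\Gamma_1\diamond\Gamma_2$ infer $M_1M_2:\langle\Gamma_1\sqcap\Gamma_2\vdash_2T\rangle$; ($\sqcap$) from $M:\langle\Gamma_1\vdash_2U_1\rangle$, $M:\langle\Gamma_2\vdash_2U_2\rangle$ infer $M:\langle\Gamma_1\sqcap\Gamma_2\vdash_2U_1\sqcap U_2\rangle$; (exp) from $M:\langle\Gamma\vdash_2U\rangle$ infer $M^+:\langle e\Gamma\vdash_2 eU\rangle$; ($\sqsubseteq$) from $M:\langle\Gamma\vdash_2U\rangle$ and $\langle\Gamma\vdash_2U\rangle\sqsubseteq\langle\Gamma'\vdash_2U'\rangle$ infer $M:\langle\Gamma'\vdash_2U'\rangle$, where $\sqsubseteq$ is the least relation (on $\mathbb U$, environments, typings) closed under reflexivity, transitivity, $U_1\sqcap U_2\sqsubseteq U_1$ (if $U_2$ good and $d(U_1)=d(U_2)$), $U_1\sqcap U_2\sqsubseteq V_1\sqcap V_2$ (if $U_i\sqsubseteq V_i$), $U_1\to T_1\sqsubseteq U_2\to T_2$ (if $U_2\sqsubseteq U_1$, $T_1\sqsubseteq T_2$), $eU_1\sqsubseteq eU_2$ (if $U_1\sqsubseteq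 U_2$), $\Gamma,(y^n:U_1)\sqsubseteq\Gamma,(y^n:U_2)$ (if $U_1\sqsubseteq U_2$), $\langle\Gamma_1\vdash_2U_1\rangle\sqsubseteq\langle\Gamma_2\vdash_2U_2\rangle$ (if $U_1\sqsubseteq U_2$, $\Gamma_2\sqsubseteq\Gamma_1$). Semantics. $\mathcal X\subseteq\mathcal M$ is saturated iff $M\rhd_\beta^*N$, $N\in\mathcal X$ imply $M\in\mathcal X$. $\mathcal X\leadsto\mathcal Y=\{M\in\mathcal M\mid\forall N\in\mathcal X,\ M\diamond N\Rightarrow MN\in\mathcal Y\}$. For $x\in\mathcal V_1$, $\mathcal N_x^0=\{x^0N_1\dots N_k\in\mathbb M\mid k\ge0\}$. An interpretation is a function $\mathcal I:\mathcal A\to\mathcal P(\mathcal M^0)$ with each $\mathcal I(a)$ saturated and $\mathcal N_x^0\subseteq\mathcal I(a)\subseteq\mathbb M^0$ for all $x\in\mathcal V_1$; it is extended by $\mathcal I(eU)=\mathcal I(U)^+$ (for every $e\in\mathcal E$), $\mathcal I(U\sqcap V)=\mathcal I(U)\cap\mathcal I(V)$, $\mathcal I(U\to T)=\mathcal I(U)\leadsto\mathcal I(T)$. The meaning of $U$ is $[U]=\{M\in\mathcal M\mid M\text{ closed and }M\in\mathcal I(U)\text{ for every interpretation }\mathcal I\}$. -}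

module Defs where

open import Data.Nat using (ℕ; zero; suc; _⊓_; _≤_; _≡ᵇ_)
open import Data.Bool using (Bool; true; false; if_then_else_; _∧_)
open import Data.List using (List; []; _∷_; foldl)
open import Data.Maybe using (Maybe; just; nothing; Is-just)
import Data.Maybe as Maybe
open import Data.Product using (Σ; _×_; _,_)
open import Relation.Nullary using (¬_; Dec; yes; no; does)
open import Relation.Binary.PropositionalEquality using (_≡_; _≢_; refl; cong)
open import Relation.Binary.Construct.Closure.ReflexiveTransitive using (Star)
import Data.Nat as ℕ

-- Variable names: 𝓥 = 𝓥₁ ∪ 𝓥₂, disjoint, both denumerably infinite.

data Name : Set where
  v₁ : ℕ → Name
  v₂ : ℕ → Name

data V₁ : Name → Set where
  inV₁ : ∀ k → V₁ (v₁ k)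

_≟ᴺ_ : (x y : Name) → Dec (x ≡ y)
v₁ m ≟ᴺ v₁ n with m ℕ.≟ n
... | yes refl = yes refl
... | no p = no λ { refl → p refl }
v₁ m ≟ᴺ v₂ n = no λ ()
v₂ m ≟ᴺ v₁ n = no λ ()
v₂ m ≟ᴺ v₂ n with m ℕ.≟ n
... | yes refl = yes refl
... | no p = no λ { refl → p refl }

sameVar : Name → ℕ → Name → ℕ → Bool
sameVar y m x n = does (y ≟ᴺ x) ∧ (m ≡ᵇ n)

-- Raw syntax (locally nameless): free variables are named indexed
-- variables x^n, bound variables are de Bruijn indices carrying their
-- degree, binders carry the index of the bound variable.  Terms modulo
-- α-conversion are exactly the well-formed raw terms (IsTerm below).

data Raw : Set where
  fv  : Name → ℕ → Raw
  bv  : ℕ → ℕ → Raw             -- bound variable (de Bruijn index, degree)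
  app : Raw → Raw → Raw
  lam : ℕ → Raw → Raw

closeAt : ℕ → Name → ℕ → Raw → Raw
closeAt k x n (fv y m)  = if sameVar y m x n then bv k n else fv y m
closeAt k x n (bv j m)  = bv j m
closeAt k x n (app M N) = app (closeAt k x n M) (closeAt k x n N)
closeAt k x n (lam m M) = lam m (closeAt (suc k) x n M)

close : Name → ℕ → Raw → Raw
close = closeAt 0

ƛ : Name → ℕ → Raw → Raw
ƛ x n M = lam n (close x n M)

-- substitution M[x^n := N] of a free variable (N closed w.r.t. bound
-- variables, so no capture is possible)
_[_,_≔_] : Raw → Name → ℕ → Raw → Raw
fv y m    [ x , n ≔ N ] = if sameVar y m x n then N else fv y m
bv j m    [ x , n ≔ N ] = bv j m
app M₁ M₂ [ x , n ≔ N ] = app (M₁ [ x , n ≔ N ]) (M₂ [ x , n ≔ N ])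
lam m M   [ x , n ≔ N ] = lam m (M [ x , n ≔ N ])

data FV : Name → ℕ → Raw → Set where
  fv-var  : ∀ {x n} → FV x n (fv x n)
  fv-appˡ : ∀ {x n M N} → FV x n M → FV x n (app M N)
  fv-appʳ : ∀ {x n M N} → FV x n N → FV x n (app M N)
  fv-lam  : ∀ {x n m M} → FV x n M → FV x n (lam m M)

deg : Raw → ℕ
deg (fv x n)  = n
deg (bv k n)  = n
deg (app M N) = deg M ⊓ deg N
deg (lam n M) = deg M

_◇_ : Raw → Raw → Set
M ◇ N = ∀ x m n → FV x m M → FV x n N → m ≡ n

data IsTerm : Raw → Set where
  t-var : ∀ x n → IsTerm (fv x n)
  t-app : ∀ {M N} → IsTerm M → IsTerm N → M ◇ N → IsTerm (app M N)
  t-lam : ∀ {x n M} → IsTerm M → FV x n M → IsTerm (ƛ x n M)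

data IsGood : Raw → Set where
  g-var : ∀ x n → IsGood (fv x n)
  g-app : ∀ {M N} → IsGood M → IsGood N → M ◇ N → deg M ≤ deg N →
          IsGood (app M N)
  g-lam : ∀ {x n M} → IsGood M → FV x n M → IsGood (ƛ x n M)

_⁺ : Raw → Raw
fv x n  ⁺ = fv x (suc n)
bv k n  ⁺ = bv k (suc n)
app M N ⁺ = app (M ⁺) (N ⁺)
lam n M ⁺ = lam (suc n) (M ⁺)

Closed : Raw → Set
Closed M = IsTerm M × (∀ x n → ¬ FV x n M)

data _▷β_ : Raw → Raw → Set where
  β    : ∀ {x n M N} → IsTerm (app (ƛ x n M) N) → deg N ≡ n →
         app (ƛ x n M) N ▷β (M [ x , n ≔ N ])
  appˡ : ∀ {M M' N} → IsTerm (app M N) → M ▷β M' → app M N ▷β app M' N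
  appʳ : ∀ {M N N'} → IsTerm (app M N) → N ▷β N' → app M N ▷β app M N'
  lamᶜ : ∀ {x n M M'} → IsTerm (ƛ x n M) → M ▷β M' → ƛ x n M ▷β ƛ x n M'

_▷β*_ : Raw → Raw → Set
_▷β*_ = Star _▷β_

Atom : Set
Atom = ℕ

EVar : Set
EVar = ℕ

infixr 7 _⇒_
infixl 6 _⊓ᵤ_

mutual
  data 𝕋 : Set where
    atom : Atom → 𝕋
    _⇒_  : 𝕌 → 𝕋 → 𝕋

  data 𝕌 : Set where
    _⊓ᵤ_ : 𝕌 → 𝕌 → 𝕌
    ex   : EVar → 𝕌 → 𝕌
    ⌜_⌝  : 𝕋 → 𝕌

mutual
  data _≈ᵤ_ : 𝕌 → 𝕌 → Set where
    ≈refl  : ∀ {U} → U ≈ᵤ U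
    ≈sym   : ∀ {U V} → U ≈ᵤ V → V ≈ᵤ U
    ≈trans : ∀ {U V W} → U ≈ᵤ V → V ≈ᵤ W → U ≈ᵤ W
    ⊓-comm  : ∀ {U V} → (U ⊓ᵤ V) ≈ᵤ (V ⊓ᵤ U)
    ⊓-assoc : ∀ {U V W} → ((U ⊓ᵤ V) ⊓ᵤ W) ≈ᵤ (U ⊓ᵤ (V ⊓ᵤ W))
    ⊓-idem  : ∀ {U} → (U ⊓ᵤ U) ≈ᵤ U
    ex-dist : ∀ {e U V} → ex e (U ⊓ᵤ V) ≈ᵤ (ex e U ⊓ᵤ ex e V)
    ⊓-cong  : ∀ {U U' V V'} → U ≈ᵤ U' → V ≈ᵤ V' → (U ⊓ᵤ V) ≈ᵤ (U' ⊓ᵤ V')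
    ex-cong : ∀ {e U V} → U ≈ᵤ V → ex e U ≈ᵤ ex e V
    ⌜⌝-cong : ∀ {T T'} → T ≈ₜ T' → ⌜ T ⌝ ≈ᵤ ⌜ T' ⌝

  data _≈ₜ_ : 𝕋 → 𝕋 → Set where
    ≈ₜrefl  : ∀ {T} → T ≈ₜ T
    ≈ₜsym   : ∀ {T T'} → T ≈ₜ T' → T' ≈ₜ T
    ≈ₜtrans : ∀ {T T' T''} → T ≈ₜ T' → T' ≈ₜ T'' → T ≈ₜ T''
    ⇒-cong  : ∀ {U U' T T'} → U ≈ᵤ U' → T ≈ₜ T' → (U ⇒ T) ≈ₜ (U' ⇒ T')

mutual
  degᵤ : 𝕌 → ℕ
  degᵤ (U ⊓ᵤ V) = degᵤ U ⊓ degᵤ V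
  degᵤ (ex e U) = suc (degᵤ U)
  degᵤ ⌜ T ⌝    = degₜ T

  degₜ : 𝕋 → ℕ
  degₜ (atom a) = 0
  degₜ (U ⇒ T)  = degᵤ U ⊓ degₜ T

mutual
  data Goodᵤ : 𝕌 → Set where
    gd-⊓ : ∀ {U V} → Goodᵤ U → Goodᵤ V → degᵤ U ≡ degᵤ V → Goodᵤ (U ⊓ᵤ V)
    gd-ex : ∀ {e U} → Goodᵤ U → Goodᵤ (ex e U)
    gd-T  : ∀ {T} → Goodₜ T → Goodᵤ ⌜ T ⌝

  data Goodₜ : 𝕋 → Set where
    gd-atom : ∀ {a} → Goodₜ (atom a)
    gd-⇒    : ∀ {U T} → Goodᵤ U → Goodₜ T → degₜ T ≤ degᵤ U → Goodₜ (U ⇒ T)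

data _⊑_ : 𝕌 → 𝕌 → Set where
  ⊑refl  : ∀ {U V} → U ≈ᵤ V → U ⊑ V
  ⊑trans : ∀ {U V W} → U ⊑ V → V ⊑ W → U ⊑ W
  ⊑⊓ᵉ    : ∀ {U₁ U₂} → Goodᵤ U₂ → degᵤ U₁ ≡ degᵤ U₂ → (U₁ ⊓ᵤ U₂) ⊑ U₁
  ⊑⊓     : ∀ {U₁ U₂ V₁ V₂} → U₁ ⊑ V₁ → U₂ ⊑ V₂ → (U₁ ⊓ᵤ U₂) ⊑ (V₁ ⊓ᵤ V₂)
  ⊑⇒     : ∀ {U₁ U₂ T₁ T₂} → U₂ ⊑ U₁ → ⌜ T₁ ⌝ ⊑ ⌜ T₂ ⌝ →
           ⌜ U₁ ⇒ T₁ ⌝ ⊑ ⌜ U₂ ⇒ T₂ ⌝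
  ⊑ex    : ∀ {e U₁ U₂} → U₁ ⊑ U₂ → ex e U₁ ⊑ ex e U₂

Env : Set
Env = Name → ℕ → Maybe 𝕌

∅ : Env
∅ _ _ = nothing

⟦_^_↦_⟧ : Name → ℕ → 𝕌 → Env
⟦ x ^ n ↦ U ⟧ y m = if sameVar y m x n then just U else nothing

_∖_^_ : Env → Name → ℕ → Env
(Γ ∖ x ^ n) y m = if sameVar y m x n then nothing else Γ y m

meetᴹ : Maybe 𝕌 → Maybe 𝕌 → Maybe 𝕌
meetᴹ nothing  v        = v
meetᴹ (just U) nothing  = just U
meetᴹ (just U) (just V) = just (U ⊓ᵤ V)

_⊓ₑ_ : Env → Env → Env
(Γ ⊓ₑ Δ) y m = meetᴹ (Γ y m) (Δ y m)

expₑ : EVar → Env → Env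
expₑ e Γ y zero    = nothing
expₑ e Γ y (suc m) = Maybe.map (ex e) (Γ y m)

_◇ₑ_ : Env → Env → Set
Γ ◇ₑ Δ = ∀ x m n → Is-just (Γ x m) → Is-just (Δ x n) → m ≡ n

data _⊑ᴹ_ : Maybe 𝕌 → Maybe 𝕌 → Set where
  nothing⊑ : nothing ⊑ᴹ nothing
  just⊑    : ∀ {U V} → U ⊑ V → just U ⊑ᴹ just V

-- ⊑ on environments (closure of Γ,(y^n:U₁) ⊑ Γ,(y^n:U₂))
_⊑ₑ_ : Env → Env → Set
Γ ⊑ₑ Δ = ∀ y m → Γ y m ⊑ᴹ Δ y m

data _∶⟨_⊢₂_⟩ : Raw → Env → 𝕌 → Set where
  ax  : ∀ {x T} → Goodₜ T → fv x 0 ∶⟨ ⟦ x ^ 0 ↦ ⌜ T ⌝ ⟧ ⊢₂ ⌜ T ⌝ ⟩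
  →I  : ∀ {M Δ x n U T} → M ∶⟨ Δ ⊢₂ ⌜ T ⌝ ⟩ → Δ x n ≡ just U →
        ƛ x n M ∶⟨ Δ ∖ x ^ n ⊢₂ ⌜ U ⇒ T ⌝ ⟩
  →E  : ∀ {M₁ M₂ Γ₁ Γ₂ U T} → M₁ ∶⟨ Γ₁ ⊢₂ ⌜ U ⇒ T ⌝ ⟩ → M₂ ∶⟨ Γ₂ ⊢₂ U ⟩ →
        Γ₁ ◇ₑ Γ₂ → app M₁ M₂ ∶⟨ Γ₁ ⊓ₑ Γ₂ ⊢₂ ⌜ T ⌝ ⟩
  ⊓I  : ∀ {M Γ₁ Γ₂ U₁ U₂} → M ∶⟨ Γ₁ ⊢₂ U₁ ⟩ → M ∶⟨ Γ₂ ⊢₂ U₂ ⟩ →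
        M ∶⟨ Γ₁ ⊓ₑ Γ₂ ⊢₂ U₁ ⊓ᵤ U₂ ⟩
  exp : ∀ {M Γ U} e → M ∶⟨ Γ ⊢₂ U ⟩ → (M ⁺) ∶⟨ expₑ e Γ ⊢₂ ex e U ⟩
  sub : ∀ {M Γ Γ' U U'} → M ∶⟨ Γ ⊢₂ U ⟩ → Γ' ⊑ₑ Γ → U ⊑ U' →
        M ∶⟨ Γ' ⊢₂ U' ⟩

Pred : Set₁
Pred = Raw → Set

Saturated : Pred → Set
Saturated X = ∀ M N → M ▷β* N → X N → X M

_⇝_ : Pred → Pred → Pred
(X ⇝ Y) M = IsTerm M × (∀ N → X N → M ◇ N → Y (app M N))

_⁺ˢ : Pred → Pred
(X ⁺ˢ) M = Σ Raw λ N → X N × M ≡ (N ⁺)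

apps : Raw → List Raw → Raw
apps = foldl app

record Interpretation : Set₁ where
  field
    I        : Atom → Pred
    sat      : ∀ a → Saturated (I a)
    neutral  : ∀ a x → V₁ x → ∀ Ns → IsGood (apps (fv x 0) Ns) →
               I a (apps (fv x 0) Ns)
    good0    : ∀ a M → I a M → IsGood M × deg M ≡ 0

open Interpretation public

mutual
  ⟦_⟧ᵤ : 𝕌 → Interpretation → Pred
  ⟦ U ⊓ᵤ V ⟧ᵤ ℐ M = ⟦ U ⟧ᵤ ℐ M × ⟦ V ⟧ᵤ ℐ M
  ⟦ ex e U ⟧ᵤ ℐ   = (⟦ U ⟧ᵤ ℐ) ⁺ˢ
  ⟦ ⌜ T ⌝ ⟧ᵤ ℐ    = ⟦ T ⟧ₜ ℐ

  ⟦_⟧ₜ : 𝕋 → Interpretation → Pred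
  ⟦ atom a ⟧ₜ ℐ = I ℐ a
  ⟦ U ⇒ T ⟧ₜ ℐ  = ⟦ U ⟧ᵤ ℐ ⇝ ⟦ T ⟧ₜ ℐ

[_] : 𝕌 → Raw → Set₁
[ U ] M = Closed M × (∀ (ℐ : Interpretation) → ⟦ U ⟧ᵤ ℐ M)

Nat₀ : Atom → EVar → EVar → 𝕌
Nat₀ a e₁ e₂ = ⌜ ⌜ ex e₁ ⌜ atom a ⌝ ⇒ atom a ⌝ ⇒ (ex e₂ ⌜ atom a ⌝ ⇒ atom a) ⌝

-- λf⁰.f⁰  (= ƛ f 0 (fv f 0) for any name f)
idTm : Raw
idTm = lam 0 (bv 0 0)

module Submission where

-- Soundness of the meaning: the interpretation of an expansion ex e U is
-- I(U)⁺ whatever e is, so a function of type e₁a → a also accepts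
-- arguments of type e₂a.  Hence, for N ∈ I(e₁a → a) and P = Q⁺ ∈ I(e₂a),
-- N P ∈ I(a); as P has positive degree, N has degree 0, so λf⁰.f⁰ N P
-- β-reduces to N P and saturation gives λf⁰.f⁰ ∈ I(Nat₀).
--
-- Non-derivability: the typing system does distinguish e₁ from e₂.  We
-- interpret types as predicates on Bool, reading atoms as "is true" and
-- ex e as the identity when e = e₁ and as the constant true otherwise.
-- This reading respects the type quotient and subtyping, and every type
-- derived for λf⁰.f⁰ (in any environment) is valid in it, because such a
-- derivation ends, up to ⊓, exp and ⊑, in →I applied to a derivation for
-- the variable f⁰.  But Nat₀ is not valid when e₁ ≢ e₂.

open import Defs
open import Data.Bool using (Bool; true; false; if_then_else_)
open import Data.Bool.Properties using (T-≡)
open import Data.Empty using (⊥-elim)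
open import Data.Maybe using (just; nothing)
open import Data.Nat using (zero; suc; _⊓_)
import Data.Nat as ℕ
open import Data.Nat.Properties using (≡ᵇ⇒≡; ≡⇒≡ᵇ)
open import Data.Product using (Σ; _×_; _,_; proj₁; proj₂)
open import Function.Bundles using (_⇔_; mk⇔; Equivalence)
open import Function.Properties.Equivalence as ⇔ using ()
open import Data.Product.Function.NonDependent.Propositional using (_×-⇔_)
open import Function using (_∘′_)
open import Relation.Nullary using (¬_; yes; no)
open import Relation.Binary.PropositionalEquality
  using (_≡_; _≢_; refl; sym; trans; cong; cong₂; subst)
open import Relation.Binary.Construct.Closure.ReflexiveTransitive using (ε; _◅_)

open Equivalence using (to; from)

sameVar-refl : ∀ x n → sameVar x n x n ≡ true
sameVar-refl x n with x ≟ᴺ x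
... | yes _   = to T-≡ (≡⇒≡ᵇ n n refl)
... | no x≢x  = ⊥-elim (x≢x refl)

sameVar-sound : ∀ y m x n → sameVar y m x n ≡ true → y ≡ x × m ≡ n
sameVar-sound y m x n same with y ≟ᴺ x
... | yes y≡x = y≡x , ≡ᵇ⇒≡ m n (from T-≡ same)

good⇒term : ∀ {M} → IsGood M → IsTerm M
good⇒term (g-var x n)         = t-var x n
good⇒term (g-app gM gN M◇N _) = t-app (good⇒term gM) (good⇒term gN) M◇N
good⇒term (g-lam gM x∈M)      = t-lam (good⇒term gM) x∈M

deg-⁺ : ∀ M → deg (M ⁺) ≡ suc (deg M)
deg-⁺ (fv x n)  = refl
deg-⁺ (bv k n)  = refl
deg-⁺ (app M N) = cong₂ _⊓_ (deg-⁺ M) (deg-⁺ N)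
deg-⁺ (lam n M) = deg-⁺ M

-- If min(m, k+1) = 0 then m = 0: in an application of degree 0 whose
-- argument has positive degree, the function has degree 0.
⊓-suc-≡0 : ∀ m k → m ⊓ suc k ≡ 0 → m ≡ 0
⊓-suc-≡0 zero    k _  = refl
⊓-suc-≡0 (suc m) k ()

idTm-term : IsTerm idTm
idTm-term = t-lam {x = v₁ 0} {n = 0} (t-var (v₁ 0) 0) fv-var

idTm-closed : Closed idTm
idTm-closed = idTm-term , λ { x n (fv-lam ()) }

idTm-β : ∀ {N} → IsTerm (app idTm N) → deg N ≡ 0 → app idTm N ▷β N
idTm-β {N} t dN = β {x = v₁ 0} {n = 0} {M = fv (v₁ 0) 0} {N = N} t dN

idTm-expand : ∀ {X N P} → Saturated X → IsTerm (app (app idTm N) P) →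
              deg N ≡ 0 → X (app N P) → X (app (app idTm N) P)
idTm-expand {N = N} {P} sat-X t@(t-app tIdN _ _) dN =
  sat-X (app (app idTm N) P) (app N P) (appˡ t (idTm-β tIdN dN) ◅ ε)

-- In every interpretation, λf⁰.f⁰ has type (e₁U → a) → (e₂U → a):
-- both ex e₁ U and ex e₂ U are interpreted as ⟦U⟧⁺.
idTm-sem : ∀ (ℐ : Interpretation) a e₁ e₂ U →
           ⟦ ⌜ ⌜ ex e₁ U ⇒ atom a ⌝ ⇒ (ex e₂ U ⇒ atom a) ⌝ ⟧ᵤ ℐ idTm
idTm-sem ℐ a e₁ e₂ U = idTm-term , λ N N∈ id◇N →
  t-app idTm-term (proj₁ N∈) id◇N , λ { P (Q , Q∈ , refl) idN◇P →
    let N◇P : N ◇ (Q ⁺)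
        N◇P x m n x∈N x∈P = idN◇P x m n (fv-appʳ x∈N) x∈P
        NP∈ = proj₂ N∈ (Q ⁺) (Q , Q∈ , refl) N◇P
        (gNP , dNP≡0) = good0 ℐ a (app N (Q ⁺)) NP∈
        dN≡0 = ⊓-suc-≡0 (deg N) (deg Q)
                 (subst (λ k → deg N ⊓ k ≡ 0) (deg-⁺ Q) dNP≡0)
        tP = argument-term gNP
    in idTm-expand (sat ℐ a) (t-app (t-app idTm-term (proj₁ N∈) id◇N) tP idN◇P)
         dN≡0 NP∈ }
  where
  argument-term : ∀ {M P} → IsGood (app M P) → IsTerm P
  argument-term (g-app _ gP _ _) = good⇒term gP

idTm-meaning : ∀ a e₁ e₂ → [ Nat₀ a e₁ e₂ ] idTm
idTm-meaning a e₁ e₂ = idTm-closed , λ ℐ → idTm-sem ℐ a e₁ e₂ ⌜ atom a ⌝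

lam-injective : ∀ {n m M N} → lam n M ≡ lam m N → n ≡ m × M ≡ N
lam-injective refl = refl , refl

⊑ᴹ-just-inv : ∀ {m W} → m ⊑ᴹ just W → Σ 𝕌 λ W' → m ≡ just W' × W' ⊑ W
⊑ᴹ-just-inv (just⊑ W'⊑W) = _ , refl , W'⊑W

module ForgetfulModel (e₁ : EVar) where

  shift : EVar → Bool → Bool
  shift e d with e ℕ.≟ e₁
  ... | yes _ = d
  ... | no _  = true

  shift-self : ∀ d → shift e₁ d ≡ d
  shift-self d with e₁ ℕ.≟ e₁
  ... | yes _   = refl
  ... | no e≢e  = ⊥-elim (e≢e refl)

  shift-other : ∀ e d → e ≢ e₁ → shift e d ≡ true
  shift-other e d e≢e₁ with e ℕ.≟ e₁
  ... | yes e≡e₁ = ⊥-elim (e≢e₁ e≡e₁)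
  ... | no _     = refl

  mutual
    ⟪_⟫ᵤ : 𝕌 → Bool → Set
    ⟪ U ⊓ᵤ V ⟫ᵤ d = ⟪ U ⟫ᵤ d × ⟪ V ⟫ᵤ d
    ⟪ ex e U ⟫ᵤ d = ⟪ U ⟫ᵤ (shift e d)
    ⟪ ⌜ T ⌝ ⟫ᵤ  d = ⟪ T ⟫ₜ d

    ⟪_⟫ₜ : 𝕋 → Bool → Set
    ⟪ atom a ⟫ₜ d = d ≡ true
    ⟪ U ⇒ T ⟫ₜ  d = ∀ d' → ⟪ U ⟫ᵤ d' → ⟪ T ⟫ₜ d'

  _⊨_ : 𝕌 → 𝕌 → Set
  U ⊨ V = ∀ d → ⟪ U ⟫ᵤ d → ⟪ V ⟫ᵤ d

  ⊨_ : 𝕌 → Set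
  ⊨ U = ∀ d → ⟪ U ⟫ᵤ d

  mutual
    ≈ᵤ-sound : ∀ {U V} → U ≈ᵤ V → ∀ d → ⟪ U ⟫ᵤ d ⇔ ⟪ V ⟫ᵤ d
    ≈ᵤ-sound ≈refl          d = ⇔.refl
    ≈ᵤ-sound (≈sym p)       d = ⇔.sym (≈ᵤ-sound p d)
    ≈ᵤ-sound (≈trans p q)   d = ⇔.trans (≈ᵤ-sound p d) (≈ᵤ-sound q d)
    ≈ᵤ-sound ⊓-comm         d = mk⇔ (λ (u , v) → v , u) (λ (v , u) → u , v)
    ≈ᵤ-sound ⊓-assoc        d = mk⇔ (λ ((u , v) , w) → u , (v , w))
                                    (λ (u , (v , w)) → (u , v) , w)
    ≈ᵤ-sound ⊓-idem         d = mk⇔ proj₁ (λ u → u , u)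
    ≈ᵤ-sound ex-dist        d = ⇔.refl
    ≈ᵤ-sound (⊓-cong p q)   d = ≈ᵤ-sound p d ×-⇔ ≈ᵤ-sound q d
    ≈ᵤ-sound (ex-cong {e} p) d = ≈ᵤ-sound p (shift e d)
    ≈ᵤ-sound (⌜⌝-cong p)    d = ≈ₜ-sound p d

    ≈ₜ-sound : ∀ {T T'} → T ≈ₜ T' → ∀ d → ⟪ T ⟫ₜ d ⇔ ⟪ T' ⟫ₜ d
    ≈ₜ-sound ≈ₜrefl        d = ⇔.refl
    ≈ₜ-sound (≈ₜsym p)     d = ⇔.sym (≈ₜ-sound p d)
    ≈ₜ-sound (≈ₜtrans p q) d = ⇔.trans (≈ₜ-sound p d) (≈ₜ-sound q d)
    ≈ₜ-sound (⇒-cong p q)  d = mk⇔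
      (λ f d' u → to   (≈ₜ-sound q d') (f d' (from (≈ᵤ-sound p d') u)))
      (λ f d' u → from (≈ₜ-sound q d') (f d' (to   (≈ᵤ-sound p d') u)))

  ⊑-sound : ∀ {U V} → U ⊑ V → U ⊨ V
  ⊑-sound (⊑refl p)     d   = to (≈ᵤ-sound p d)
  ⊑-sound (⊑trans p q)  d   = ⊑-sound q d ∘′ ⊑-sound p d
  ⊑-sound (⊑⊓ᵉ _ _)     d   = proj₁
  ⊑-sound (⊑⊓ p q)      d (u , v) = ⊑-sound p d u , ⊑-sound q d v
  ⊑-sound (⊑⇒ p q)      d f d' u = ⊑-sound q d' (f d' (⊑-sound p d' u))
  ⊑-sound (⊑ex {e} p)   d   = ⊑-sound p (shift e d)

  var-generation : ∀ {M Γ U} x → M ∶⟨ Γ ⊢₂ U ⟩ → M ≡ fv x 0 →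
                   Σ 𝕌 λ W → Γ x 0 ≡ just W × W ⊨ U
  var-generation x (ax {T = T} _) refl =
    ⌜ T ⌝ , cong (λ b → if b then just ⌜ T ⌝ else nothing) (sameVar-refl x 0)
          , λ d u → u
  var-generation x (⊓I D₁ D₂) M≡x
    with var-generation x D₁ M≡x | var-generation x D₂ M≡x
  ... | W₁ , Γ₁x , W₁⊨U₁ | W₂ , Γ₂x , W₂⊨U₂ =
    W₁ ⊓ᵤ W₂ , cong₂ meetᴹ Γ₁x Γ₂x , λ d (w₁ , w₂) → W₁⊨U₁ d w₁ , W₂⊨U₂ d w₂
  var-generation x (exp {fv _ _} e _) ()
  var-generation x (sub {Γ' = Γ'} D Γ'⊑Γ U⊑U') M≡x
    with var-generation x D M≡x
  ... | W , Γx , W⊨U with ⊑ᴹ-just-inv (subst (Γ' x 0 ⊑ᴹ_) Γx (Γ'⊑Γ x 0))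
  ... | W' , Γ'x , W'⊑W =
    W' , Γ'x , λ d w' → ⊑-sound U⊑U' d (W⊨U d (⊑-sound W'⊑W d w'))

  typable-not-bv : ∀ {M Γ U} k n → M ∶⟨ Γ ⊢₂ U ⟩ → M ≢ bv k n
  typable-not-bv k n (⊓I D _)              M≡bv = typable-not-bv k n D M≡bv
  typable-not-bv k n (exp {bv _ n'} _ D)   refl = typable-not-bv k n' D refl
  typable-not-bv k n (sub D _ _)           M≡bv = typable-not-bv k n D M≡bv

  close-to-bv : ∀ {M Γ U} x n → M ∶⟨ Γ ⊢₂ U ⟩ → close x n M ≡ bv 0 0 →
                M ≡ fv x n
  close-to-bv {fv y m} x n D closed with sameVar y m x n in same
  ... | true with sameVar-sound y m x n same
  ...   | refl , refl = refl
  close-to-bv {fv y m} x n D () | false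
  close-to-bv {bv j m} x n D refl = ⊥-elim (typable-not-bv 0 0 D refl)

  idTm-valid : ∀ {M Γ U} → M ∶⟨ Γ ⊢₂ U ⟩ → M ≡ idTm → ⊨ U
  idTm-valid (→I {x = x} D Δx) abs≡id d
    with refl , body≡bv ← lam-injective abs≡id
    with refl ← close-to-bv x 0 D body≡bv
    with W , Δx' , W⊨T ← var-generation x D refl
    with refl ← trans (sym Δx') Δx = W⊨T
  idTm-valid (⊓I D₁ D₂)        M≡id d = idTm-valid D₁ M≡id d , idTm-valid D₂ M≡id d
  idTm-valid (exp {lam _ _} _ _) ()
  idTm-valid (sub D _ U⊑U')    M≡id d = ⊑-sound U⊑U' d (idTm-valid D M≡id d)

  -- In the model e₁a → a is valid (ex e₁ acts as the identity) while e₂a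
  -- holds everywhere, so (e₁a → a) → (e₂a → a) fails at false.
  Nat₀-invalid : ∀ a e₂ → e₂ ≢ e₁ → ¬ ⊨ Nat₀ a e₁ e₂
  Nat₀-invalid a e₂ e₂≢e₁ valid =
    false≢true (valid true true e₁a⇒a false (shift-other e₂ false e₂≢e₁))
    where
    e₁a⇒a : ⟪ ex e₁ ⌜ atom a ⌝ ⇒ atom a ⟫ₜ true
    e₁a⇒a d e₁a = trans (sym (shift-self d)) e₁a

    false≢true : false ≢ true
    false≢true ()

mainTheorem8 : (a : Atom) (e₁ e₂ : EVar) → e₁ ≢ e₂ →
    [ Nat₀ a e₁ e₂ ] idTm × ¬ (idTm ∶⟨ ∅ ⊢₂ Nat₀ a e₁ e₂ ⟩)
mainTheorem8 a e₁ e₂ e₁≢e₂ =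
  idTm-meaning a e₁ e₂ ,
  λ D → Nat₀-invalid a e₂ (e₁≢e₂ ∘′ sym) (idTm-valid D refl)
  where open ForgetfulModel e₁
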